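{- For $p=000$, we have $$C_p(x,y)=\frac{1-x^2-x^2y}{1-x-2x^2-x^2y+x^3+x^4-x^4y}.$$
   Context: A Catalan word of length $n\geq 1$ is a word $w_1\ldots w_n$ over the non-negative integers with $w_1=0$ and $0\leq w_i\leq w_{i-1}+1$ for $2\leq i\leq n$; the empty word is the unique Catalan word of length $0$. A word $w$ contains the pattern $p=p_1\ldots p_k$ if there are indices $i_1<\cdots<i_k$ such that $w_{i_1}\ldots w_{i_k}$ is order-isomorphic to $p$ (for all $a,b$: $w_{i_a}<w_{i_b}$ iff $p_a<p_b$, and $w_{i_a}=w_{i_b}$ iff $p_a=p_b$); otherwise $w$ avoids $p$. $\mathcal{C}_n(p)$ is the set of Catalan words of length $n$ avoiding $p$. A descent of $w$ is an index $i$ with $w_i>w_{i+1}$. $C_p(x,y)=\sum_{n,k\geq 0}c_{n,k}x^ny^k$, where $c_{n,k}$ is the number of words in $\mathcal{C}_n(p)$ with exactly $k$ descents. -}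

module Defs where

open import Data.Bool using (Bool; true; false; _∧_; _∨_; not; if_then_else_)
open import Data.Nat using (ℕ; zero; suc; _+_; _∸_; _≡ᵇ_; _<ᵇ_; _≤ᵇ_)
open import Data.Integer as ℤ using (ℤ; +_)
open import Data.List using (List; []; _∷_; map; filter; length; concatMap; upTo; foldr; zip)
open import Data.Bool.ListAction using (any; all)
open import Data.Product using (_×_; _,_)
open import Relation.Binary.PropositionalEquality using (_≡_)
open import Relation.Nullary.Decidable using (Dec; yes; no)

T? : (b : Bool) → Dec (b ≡ true)
T? true  = yes _≡_.refl
T? false = no (λ ())

stepOK : ℕ → List ℕ → Bool
stepOK prev []       = true
stepOK prev (y ∷ ys) = (y ≤ᵇ suc prev) ∧ stepOK y ys

isCatalan : List ℕ → Bool
isCatalan []       = true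
isCatalan (x ∷ xs) = (x ≡ᵇ 0) ∧ stepOK x xs

wordsOver : ℕ → ℕ → List (List ℕ)
wordsOver m zero    = [] ∷ []
wordsOver m (suc n) = concatMap (λ a → map (a ∷_) (wordsOver m n)) (upTo m)

-- every Catalan word of length n has all letters ≤ n-1, so it occurs here
catalanWords : ℕ → List (List ℕ)
catalanWords n = filter (λ w → T? (isCatalan w)) (wordsOver n n)

subseqs : List ℕ → List (List ℕ)
subseqs []       = [] ∷ []
subseqs (x ∷ xs) = let r = subseqs xs in map (x ∷_) r Data.List.++ r

indexed : List ℕ → List (ℕ × ℕ)
indexed xs = zip (upTo (length xs)) xs

_==_ : Bool → Bool → Bool
true  == b = b
false == b = not b

orderIso : List ℕ → List ℕ → Bool
orderIso u p =
  (length u ≡ᵇ length p) ∧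
  all (λ { (a , ua , pa) → all (λ { (b , ub , pb) →
        ((ua <ᵇ ub) == (pa <ᵇ pb)) ∧ ((ua ≡ᵇ ub) == (pa ≡ᵇ pb)) })
      (zip (upTo (length u)) (zip u p)) })
    (zip (upTo (length u)) (zip u p))

contains : List ℕ → List ℕ → Bool
contains p w = any (λ s → orderIso s p) (subseqs w)

avoids : List ℕ → List ℕ → Bool
avoids p w = not (contains p w)

des : List ℕ → ℕ
des []           = 0
des (x ∷ [])     = 0
des (x ∷ y ∷ ys) = (if y <ᵇ x then 1 else 0) + des (y ∷ ys)

cnk : List ℕ → ℕ → ℕ → ℕ
cnk p n k = length (filter (λ w → T? (avoids p w ∧ (des w ≡ᵇ k))) (catalanWords n))

-- Bivariate polynomials (finite lists of monomials c·x^i·y^j) and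
-- coefficient extraction of (polynomial) × (power series).

Poly : Set
Poly = List (ℕ × ℕ × ℤ)

polyCoeff : Poly → ℕ → ℕ → ℤ
polyCoeff P n k = foldr (λ { (i , j , c) acc →
  (if (i ≡ᵇ n) ∧ (j ≡ᵇ k) then c else + 0) ℤ.+ acc }) (+ 0) P

mulCoeff : Poly → (ℕ → ℕ → ℕ) → ℕ → ℕ → ℤ
mulCoeff P f n k = foldr (λ { (i , j , c) acc →
  (if (i ≤ᵇ n) ∧ (j ≤ᵇ k) then c ℤ.* (+ f (n ∸ i) (k ∸ j)) else + 0) ℤ.+ acc }) (+ 0) P

p000 : List ℕ
p000 = 0 ∷ 0 ∷ 0 ∷ []

numer : Poly
numer = (0 , 0 , + 1) ∷ (2 , 0 , ℤ.- (+ 1)) ∷ (2 , 1 , ℤ.- (+ 1)) ∷ []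

denom : Poly
denom = (0 , 0 , + 1) ∷ (1 , 0 , ℤ.- (+ 1)) ∷ (2 , 0 , ℤ.- (+ 2)) ∷ (2 , 1 , ℤ.- (+ 1))
      ∷ (3 , 0 , + 1) ∷ (4 , 0 , + 1) ∷ (4 , 1 , ℤ.- (+ 1)) ∷ []

module Submission where

-- A word avoids 000 iff no letter occurs three times. Hence an admissible word (Catalan, avoiding 000) is
-- either 0(A+1) or 0(A+1)0(B+1), with A, B Catalan, where +1 raises every letter and A ++ B must again avoid 000.
-- In the second case the step from A+1 down to 0 is one extra descent when A is nonempty. Pairs (A, B)
-- with both parts nonempty lose nothing by deleting their leading 0s, so there are c_{|i-j|} pairs of
-- lengths (i, j). This yields c_{n+2} = c_{n+1} + c_n + y T_n with
-- T_n = Σ_{i<n} c_{|i+1-(n-1-i)|} and T_{n+2} = c_n + T_n + c_{n+2}; eliminating T gives the recurrence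
-- encoded by the denominator. Counts are sums over all words on {0, …, m - 1}, and m may be enlarged
-- freely because the letters of a Catalan word of length n are < n.

open import Defs
open import Data.Bool using (Bool; true; false; _∧_; _∨_; not; T; if_then_else_)
open import Data.Bool.Properties using (∧-zeroʳ; ∧-identityʳ; ∧-assoc; ∨-zeroʳ; ∨-assoc; T-∨; T-∧; T-≡)
open import Data.Bool.ListAction using (any; or)
open import Data.Nat
  using (ℕ; zero; suc; _+_; _∸_; _≤_; _<_; z≤n; s≤s; s≤s⁻¹; _≤′_; ≤′-refl; ≤′-step; _≡ᵇ_; _<ᵇ_; _≤ᵇ_; ∣_-_∣)
open import Data.Nat.Properties
open import Data.Fin as Fin using (Fin; toℕ; inject₁; fromℕ)
open import Data.Fin.Patterns using (0F)
open import Data.Fin.Properties using (toℕ-inject₁; toℕ-fromℕ; toℕ<n)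
open import Data.List using (List; []; _∷_; map; filter; length; concatMap; applyUpTo; _++_)
open import Data.List.Properties using (filter-++; length-++; map-cong; ++-identityʳ)
open import Data.List.Membership.Propositional using (_∈_)
open import Data.List.Membership.Propositional.Properties using (∈-++⁺ʳ)
open import Data.List.Relation.Unary.All as All using (All; []; _∷_)
open import Data.List.Relation.Unary.Any using (here; there)
open import Relation.Nullary using (¬_; contradiction)
open import Data.Integer as ℤ using (ℤ) renaming (+_ to pos)
import Data.Integer.Properties as ℤ
open import Data.Integer.Tactic.RingSolver renaming (solve-∀ to ℤ-solve-∀)
open import Data.Nat.Tactic.RingSolver using (solve-∀)
open import Data.Product using (_,_)
open import Data.Sum using (_⊎_; inj₁; inj₂)
open import Function using (_∘_; id; Equivalence)
open import Relation.Binary.PropositionalEquality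
open import Algebra.Properties.CommutativeSemigroup +-commutativeSemigroup using (x∙yz≈y∙xz)
open import Algebra.Properties.CommutativeMonoid.Sum +-0-commutativeMonoid
  using (sum-syntax; sum-cong-≗; sum-replicate-zero; sum-init-last; ∑-distrib-+; ∑-comm)

𝟙 : Bool → ℕ
𝟙 true  = 1
𝟙 false = 0

count : (List ℕ → Bool) → List (List ℕ) → ℕ
count P ws = length (filter (λ w → T? (P w)) ws)

count-∷ : ∀ P w ws → count P (w ∷ ws) ≡ 𝟙 (P w) + count P ws
count-∷ P w ws with P w
... | true  = refl
... | false = refl

count-++ : ∀ P ws vs → count P (ws ++ vs) ≡ count P ws + count P vs
count-++ P ws vs =
  trans (cong length (filter-++ (λ w → T? (P w)) ws vs)) (length-++ (filter (λ w → T? (P w)) ws))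

count-map-∷ : ∀ P (a : ℕ) ws → count P (map (a ∷_) ws) ≡ count (P ∘ (a ∷_)) ws
count-map-∷ P a []       = refl
count-map-∷ P a (w ∷ ws) = begin
  count P ((a ∷ w) ∷ map (a ∷_) ws)        ≡⟨ count-∷ P (a ∷ w) _ ⟩
  𝟙 (P (a ∷ w)) + count P (map (a ∷_) ws)  ≡⟨ cong (𝟙 (P (a ∷ w)) +_) (count-map-∷ P a ws) ⟩
  𝟙 (P (a ∷ w)) + count (P ∘ (a ∷_)) ws    ≡⟨ count-∷ (P ∘ (a ∷_)) w ws ⟨
  count (P ∘ (a ∷_)) (w ∷ ws)              ∎
  where open ≡-Reasoning

count-filter : ∀ (P Q : List ℕ → Bool) ws → count Q (filter (λ w → T? (P w)) ws) ≡ count (λ w → P w ∧ Q w) ws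
count-filter P Q []       = refl
count-filter P Q (w ∷ ws) with P w
... | false = count-filter P Q ws
... | true with Q w
...   | true  = cong suc (count-filter P Q ws)
...   | false = count-filter P Q ws

∑Words : ℕ → ℕ → (List ℕ → ℕ) → ℕ
∑Words m zero    f = f []
∑Words m (suc n) f = ∑[ a < m ] ∑Words m n (f ∘ (toℕ a ∷_))

count-concatMap : ∀ P ws m (h : ℕ → ℕ) →
  count P (concatMap (λ a → map (a ∷_) ws) (applyUpTo h m)) ≡ ∑[ a < m ] count (P ∘ (h (toℕ a) ∷_)) ws
count-concatMap P ws zero    h = refl
count-concatMap P ws (suc m) h =
  trans (count-++ P (map (h 0 ∷_) ws) _)
        (cong₂ _+_ (count-map-∷ P (h 0) ws) (count-concatMap P ws m (h ∘ suc)))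

count-wordsOver : ∀ P m n → count P (wordsOver m n) ≡ ∑Words m n (𝟙 ∘ P)
count-wordsOver P m zero    = trans (count-∷ P [] []) (+-identityʳ (𝟙 (P [])))
count-wordsOver P m (suc n) =
  trans (count-concatMap P (wordsOver m n) m id)
        (sum-cong-≗ {m} (λ a → count-wordsOver (P ∘ (toℕ a ∷_)) m n))

∑-vanish : ∀ n {g : Fin n → ℕ} → (∀ i → g i ≡ 0) → ∑[ i < n ] g i ≡ 0
∑-vanish n g≡0 = trans (sum-cong-≗ {n} g≡0) (sum-replicate-zero n)

∑Words-cong : ∀ m n {f g : List ℕ → ℕ} → (∀ w → length w ≡ n → f w ≡ g w) → ∑Words m n f ≡ ∑Words m n g
∑Words-cong m zero    f≗g = f≗g [] refl
∑Words-cong m (suc n) f≗g = sum-cong-≗ {m} (λ a → ∑Words-cong m n (λ w ∣w∣≡n → f≗g (toℕ a ∷ w) (cong suc ∣w∣≡n)))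

∑Words-vanish : ∀ m n {f : List ℕ → ℕ} → (∀ w → length w ≡ n → f w ≡ 0) → ∑Words m n f ≡ 0
∑Words-vanish m zero    f≗0 = f≗0 [] refl
∑Words-vanish m (suc n) f≗0 =
  ∑-vanish m (λ a → ∑Words-vanish m n (λ w ∣w∣≡n → f≗0 (toℕ a ∷ w) (cong suc ∣w∣≡n)))

shift : List ℕ → List ℕ
shift = map suc

-- A word over {0, …, m} is either 0-free or shift A ++ 0 ∷ v, where |A| = i is the position of its first 0.
∑Words-split-zero : ∀ m n (h : List ℕ → ℕ) →
  ∑Words (suc m) n h ≡
  ∑Words m n (h ∘ shift) +
  ∑[ i < n ] ∑Words m (toℕ i) (λ A → ∑Words (suc m) (n ∸ suc (toℕ i)) (λ v → h (shift A ++ 0 ∷ v)))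
∑Words-split-zero m zero    h = sym (+-identityʳ (h []))
∑Words-split-zero m (suc n) h = begin
  Z + ∑[ a < m ] ∑Words (suc m) n (h ∘ (suc (toℕ a) ∷_))
    ≡⟨ cong (Z +_) (sum-cong-≗ {m} (λ a → ∑Words-split-zero m n (h ∘ (suc (toℕ a) ∷_)))) ⟩
  Z + ∑[ a < m ] (P a + ∑[ i < n ] R a i)
    ≡⟨ cong (Z +_) (∑-distrib-+ P (λ a → ∑[ i < n ] R a i)) ⟩
  Z + (∑[ a < m ] P a + ∑[ a < m ] ∑[ i < n ] R a i)
    ≡⟨ x∙yz≈y∙xz Z (∑[ a < m ] P a) (∑[ a < m ] ∑[ i < n ] R a i) ⟩
  ∑[ a < m ] P a + (Z + ∑[ a < m ] ∑[ i < n ] R a i)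
    ≡⟨ cong (λ t → ∑[ a < m ] P a + (Z + t)) (∑-comm R) ⟩
  ∑[ a < m ] P a + (Z + ∑[ i < n ] ∑[ a < m ] R a i) ∎
  where
  open ≡-Reasoning
  Z : ℕ
  Z = ∑Words (suc m) n (h ∘ (0 ∷_))
  P : Fin m → ℕ
  P a = ∑Words m n (h ∘ shift ∘ (toℕ a ∷_))
  R : Fin m → Fin n → ℕ
  R a i = ∑Words m (toℕ i) (λ A → ∑Words (suc m) (n ∸ suc (toℕ i)) (λ v → h (suc (toℕ a) ∷ shift A ++ 0 ∷ v)))

∑Words-head-zero : ∀ m n {f : List ℕ → ℕ} → (∀ a w → f (suc a ∷ w) ≡ 0) →
  ∑Words (suc m) (suc n) f ≡ ∑Words (suc m) n (f ∘ (0 ∷_))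
∑Words-head-zero m n {f} f≡0 =
  trans (cong (∑Words (suc m) n (f ∘ (0 ∷_)) +_)
              (∑-vanish m (λ a → ∑Words-vanish (suc m) n (λ w _ → f≡0 (toℕ a) w))))
        (+-identityʳ _)

∑Words-shift : ∀ m n {h : List ℕ → ℕ} → (∀ w → 0 ∈ w → h w ≡ 0) →
  ∑Words (suc m) n h ≡ ∑Words m n (h ∘ shift)
∑Words-shift m n {h} h≡0 =
  trans (∑Words-split-zero m n h)
        (trans (cong (∑Words m n (h ∘ shift) +_) (∑-vanish n (λ i → ∑Words-vanish m (toℕ i) (λ A _ →
                  ∑Words-vanish (suc m) (n ∸ suc (toℕ i)) (λ v _ →
                    h≡0 (shift A ++ 0 ∷ v) (∈-++⁺ʳ (shift A) (here refl)))))))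
               (+-identityʳ _))

∑Words-stable : ∀ m n {f : List ℕ → ℕ} → (∀ w → length w ≡ n → ¬ All (_< m) w → f w ≡ 0) →
  ∑Words (suc m) n f ≡ ∑Words m n f
∑Words-stable m zero    f≡0 = refl
∑Words-stable m (suc n) {f} f≡0 = begin
  ∑[ a < suc m ] F a                                  ≡⟨ sum-init-last F ⟩
  ∑[ a < m ] F (inject₁ a) + F (fromℕ m)              ≡⟨ cong₂ _+_ (sum-cong-≗ {m} below-m) at-m ⟩
  ∑[ a < m ] ∑Words m n (f ∘ (toℕ a ∷_)) + 0         ≡⟨ +-identityʳ _ ⟩
  ∑[ a < m ] ∑Words m n (f ∘ (toℕ a ∷_))             ∎
  where
  open ≡-Reasoning
  F : Fin (suc m) → ℕ
  F a = ∑Words (suc m) n (f ∘ (toℕ a ∷_))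
  below-m : ∀ a → F (inject₁ a) ≡ ∑Words m n (f ∘ (toℕ a ∷_))
  below-m a rewrite toℕ-inject₁ a = ∑Words-stable m n (λ w ∣w∣≡n ¬w<m →
    f≡0 (toℕ a ∷ w) (cong suc ∣w∣≡n) (λ { (_ ∷ w<m) → ¬w<m w<m }))
  at-m : F (fromℕ m) ≡ 0
  at-m rewrite toℕ-fromℕ m = ∑Words-vanish (suc m) n (λ w ∣w∣≡n →
    f≡0 (m ∷ w) (cong suc ∣w∣≡n) (λ { (m<m ∷ _) → <-irrefl refl m<m }))

occ : ℕ → List ℕ → ℕ
occ a []       = 0
occ a (x ∷ xs) = 𝟙 (a ≡ᵇ x) + occ a xs

occ-++ : ∀ a xs ys → occ a (xs ++ ys) ≡ occ a xs + occ a ys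
occ-++ a []       ys = refl
occ-++ a (x ∷ xs) ys = trans (cong (𝟙 (a ≡ᵇ x) +_) (occ-++ a xs ys)) (sym (+-assoc (𝟙 (a ≡ᵇ x)) _ _))

hasTriple : List ℕ → Bool
hasTriple []       = false
hasTriple (x ∷ xs) = (2 ≤ᵇ occ x xs) ∨ hasTriple xs

isReplicate : ℕ → ℕ → List ℕ → Bool
isReplicate zero    x []      = true
isReplicate zero    x (_ ∷ _) = false
isReplicate (suc k) x []      = false
isReplicate (suc k) x (y ∷ s) = (x ≡ᵇ y) ∧ isReplicate k x s

n<ᵇn≡false : ∀ n → (n <ᵇ n) ≡ false
n<ᵇn≡false zero    = refl
n<ᵇn≡false (suc n) = n<ᵇn≡false n

n≡ᵇn≡true : ∀ n → (n ≡ᵇ n) ≡ true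
n≡ᵇn≡true zero    = refl
n≡ᵇn≡true (suc n) = n≡ᵇn≡true n

orderIso-xyz-000 : ∀ x y z → orderIso (x ∷ y ∷ z ∷ []) p000 ≡ isReplicate 2 x (y ∷ z ∷ [])
orderIso-xyz-000 zero    zero    zero    = refl
orderIso-xyz-000 zero    zero    (suc z) = refl
orderIso-xyz-000 zero    (suc y) z       = refl
orderIso-xyz-000 (suc x) zero    z       rewrite n<ᵇn≡false x | n≡ᵇn≡true x = refl
orderIso-xyz-000 (suc x) (suc y) zero    rewrite n<ᵇn≡false x | n≡ᵇn≡true x with x <ᵇ y | x ≡ᵇ y
... | true  | true  = refl
... | true  | false = refl
... | false | true  = refl
... | false | false = refl
orderIso-xyz-000 (suc x) (suc y) (suc z) = orderIso-xyz-000 x y z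

orderIso-000 : ∀ x s → orderIso (x ∷ s) p000 ≡ isReplicate 2 x s
orderIso-000 x []              = refl
orderIso-000 x (y ∷ [])        = sym (∧-zeroʳ (x ≡ᵇ y))
orderIso-000 x (y ∷ z ∷ [])    = orderIso-xyz-000 x y z
orderIso-000 x (y ∷ z ∷ _ ∷ _) =
  sym (trans (cong ((x ≡ᵇ y) ∧_) (∧-zeroʳ (x ≡ᵇ z))) (∧-zeroʳ (x ≡ᵇ y)))

any-map-∷-++ : ∀ (p : List ℕ → Bool) x r s → any p (map (x ∷_) r ++ s) ≡ any (p ∘ (x ∷_)) r ∨ any p s
any-map-∷-++ p x []      s = refl
any-map-∷-++ p x (t ∷ r) s =
  trans (cong (p (x ∷ t) ∨_) (any-map-∷-++ p x r s)) (sym (∨-assoc (p (x ∷ t)) _ _))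

any-const-false : ∀ (r : List (List ℕ)) → any (λ _ → false) r ≡ false
any-const-false []      = refl
any-const-false (_ ∷ r) = any-const-false r

suc≤ᵇsuc : ∀ k o → (suc k ≤ᵇ suc o) ≡ (k ≤ᵇ o)
suc≤ᵇsuc zero    o = refl
suc≤ᵇsuc (suc k) o = refl

≤ᵇ-∨-suc≤ᵇ : ∀ k o → (k ≤ᵇ o) ∨ (suc k ≤ᵇ o) ≡ (k ≤ᵇ o)
≤ᵇ-∨-suc≤ᵇ zero    o       = refl
≤ᵇ-∨-suc≤ᵇ (suc k) zero    = refl
≤ᵇ-∨-suc≤ᵇ (suc k) (suc o) rewrite suc≤ᵇsuc k o | suc≤ᵇsuc (suc k) o = ≤ᵇ-∨-suc≤ᵇ k o

any-isReplicate-subseqs : ∀ k x xs → any (isReplicate k x) (subseqs xs) ≡ (k ≤ᵇ occ x xs)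
any-isReplicate-subseqs zero    x []       = refl
any-isReplicate-subseqs (suc k) x []       = refl
any-isReplicate-subseqs zero    x (y ∷ ys) =
  trans (any-map-∷-++ (isReplicate 0 x) y (subseqs ys) (subseqs ys))
        (trans (cong (any (isReplicate 0 x ∘ (y ∷_)) (subseqs ys) ∨_) (any-isReplicate-subseqs zero x ys))
               (∨-zeroʳ (any (isReplicate 0 x ∘ (y ∷_)) (subseqs ys))))
any-isReplicate-subseqs (suc k) x (y ∷ ys)
  rewrite any-map-∷-++ (isReplicate (suc k) x) y (subseqs ys) (subseqs ys)
        | any-isReplicate-subseqs (suc k) x ys
  with x ≡ᵇ y
... | true  rewrite any-isReplicate-subseqs k x ys =
  trans (≤ᵇ-∨-suc≤ᵇ k (occ x ys)) (sym (suc≤ᵇsuc k (occ x ys)))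
... | false rewrite any-const-false (subseqs ys) = refl

contains-000 : ∀ w → contains p000 w ≡ hasTriple w
contains-000 []       = refl
contains-000 (x ∷ xs) =
  trans (any-map-∷-++ (λ s → orderIso s p000) x (subseqs xs) (subseqs xs))
        (cong₂ _∨_ (trans (cong or (map-cong (orderIso-000 x) (subseqs xs))) (any-isReplicate-subseqs 2 x xs))
                   (contains-000 xs))

occ-0-shift : ∀ A → occ 0 (shift A) ≡ 0
occ-0-shift []      = refl
occ-0-shift (_ ∷ A) = occ-0-shift A

occ-suc-shift : ∀ a A → occ (suc a) (shift A) ≡ occ a A
occ-suc-shift a []      = refl
occ-suc-shift a (x ∷ A) = cong (𝟙 (a ≡ᵇ x) +_) (occ-suc-shift a A)

occ-0-shift++0∷shift : ∀ A B → occ 0 (shift A ++ 0 ∷ shift B) ≡ 1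
occ-0-shift++0∷shift []      B = cong suc (occ-0-shift B)
occ-0-shift++0∷shift (_ ∷ A) B = occ-0-shift++0∷shift A B

occ-suc-shift++0∷shift : ∀ a A B → occ (suc a) (shift A ++ 0 ∷ shift B) ≡ occ a (A ++ B)
occ-suc-shift++0∷shift a []      B = occ-suc-shift a B
occ-suc-shift++0∷shift a (x ∷ A) B = cong (𝟙 (a ≡ᵇ x) +_) (occ-suc-shift++0∷shift a A B)

hasTriple-shift : ∀ A → hasTriple (shift A) ≡ hasTriple A
hasTriple-shift []      = refl
hasTriple-shift (x ∷ A) rewrite occ-suc-shift x A | hasTriple-shift A = refl

hasTriple-0∷shift : ∀ A → hasTriple (0 ∷ shift A) ≡ hasTriple A
hasTriple-0∷shift A rewrite occ-0-shift A = hasTriple-shift A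

hasTriple-shift++0∷shift : ∀ A B → hasTriple (shift A ++ 0 ∷ shift B) ≡ hasTriple (A ++ B)
hasTriple-shift++0∷shift []      B = hasTriple-0∷shift B
hasTriple-shift++0∷shift (x ∷ A) B
  rewrite occ-suc-shift++0∷shift x A B | hasTriple-shift++0∷shift A B = refl

hasTriple-0∷shift++0∷shift : ∀ A B → hasTriple (0 ∷ shift A ++ 0 ∷ shift B) ≡ hasTriple (A ++ B)
hasTriple-0∷shift++0∷shift A B rewrite occ-0-shift++0∷shift A B = hasTriple-shift++0∷shift A B

thrice⇒hasTriple : ∀ a w → 3 ≤ occ a w → T (hasTriple w)
thrice⇒hasTriple a (x ∷ xs) 3≤occ with a ≡ᵇ x | ≡ᵇ⇒≡ a x
... | true  | a≡x = Equivalence.from T-∨ (inj₁ (≤⇒≤ᵇ (subst (λ b → 2 ≤ occ b xs) (a≡x _) (s≤s⁻¹ 3≤occ))))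
... | false | _   = Equivalence.from T-∨ (inj₂ (thrice⇒hasTriple a xs 3≤occ))

∈⇒occ>0 : ∀ {a w} → a ∈ w → 0 < occ a w
∈⇒occ>0 {a} (here refl)  rewrite n≡ᵇn≡true a = s≤s z≤n
∈⇒occ>0 {a} (there {x} a∈w) = ≤-trans (∈⇒occ>0 a∈w) (m≤n+m _ (𝟙 (a ≡ᵇ x)))

third-zero⇒hasTriple : ∀ X v → 0 ∈ X ⊎ 0 ∈ v → T (hasTriple (0 ∷ X ++ 0 ∷ v))
third-zero⇒hasTriple X v 0∈X⊎0∈v =
  thrice⇒hasTriple 0 (0 ∷ X ++ 0 ∷ v) (s≤s (subst (2 ≤_) (sym (occ-++ 0 X (0 ∷ v))) (two-zeros 0∈X⊎0∈v)))
  where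
  two-zeros : 0 ∈ X ⊎ 0 ∈ v → 2 ≤ occ 0 X + suc (occ 0 v)
  two-zeros (inj₁ 0∈X) = ≤-trans (+-monoˡ-≤ 1 (∈⇒occ>0 0∈X)) (+-monoʳ-≤ (occ 0 X) (s≤s z≤n))
  two-zeros (inj₂ 0∈v) = ≤-trans (s≤s (∈⇒occ>0 0∈v)) (m≤n+m _ (occ 0 X))

stepOK-shift : ∀ p ys → stepOK (suc p) (shift ys) ≡ stepOK p ys
stepOK-shift p []       = refl
stepOK-shift p (y ∷ ys) = cong₂ _∧_ (suc≤ᵇsuc y (suc p)) (stepOK-shift y ys)

stepOK-++-0∷ : ∀ p xs ys → stepOK p (xs ++ 0 ∷ ys) ≡ stepOK p xs ∧ stepOK 0 ys
stepOK-++-0∷ p []       ys = refl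
stepOK-++-0∷ p (x ∷ xs) ys =
  trans (cong ((x ≤ᵇ suc p) ∧_) (stepOK-++-0∷ x xs ys)) (sym (∧-assoc (x ≤ᵇ suc p) _ _))

isCatalan-0∷shift : ∀ A → isCatalan (0 ∷ shift A) ≡ isCatalan A
isCatalan-0∷shift []          = refl
isCatalan-0∷shift (zero  ∷ A) = stepOK-shift 0 A
isCatalan-0∷shift (suc _ ∷ A) = refl

isCatalan-0∷shift++0∷shift : ∀ A B → isCatalan (0 ∷ shift A ++ 0 ∷ shift B) ≡ isCatalan A ∧ isCatalan B
isCatalan-0∷shift++0∷shift A B =
  trans (stepOK-++-0∷ 0 (shift A) (shift B)) (cong₂ _∧_ (isCatalan-0∷shift A) (isCatalan-0∷shift B))

des-shift : ∀ A → des (shift A) ≡ des A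
des-shift []          = refl
des-shift (_ ∷ [])    = refl
des-shift (x ∷ y ∷ A) = cong ((if y <ᵇ x then 1 else 0) +_) (des-shift (y ∷ A))

des-0∷shift : ∀ A → des (0 ∷ shift A) ≡ des A
des-0∷shift []      = refl
des-0∷shift (a ∷ A) = des-shift (a ∷ A)

des-suc∷shift++0∷ : ∀ p xs ys → des (suc p ∷ shift xs ++ 0 ∷ ys) ≡ des (suc p ∷ shift xs) + suc (des (0 ∷ ys))
des-suc∷shift++0∷ p []       ys = refl
des-suc∷shift++0∷ p (x ∷ xs) ys =
  trans (cong (D +_) (des-suc∷shift++0∷ x xs ys)) (sym (+-assoc D _ _))
  where
  D : ℕ
  D = if x <ᵇ p then 1 else 0

des-0∷shift++0∷shift : ∀ a A B → des (0 ∷ shift (a ∷ A) ++ 0 ∷ shift B) ≡ suc (des (a ∷ A) + des B)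
des-0∷shift++0∷shift a A B = begin
  des (suc a ∷ shift A ++ 0 ∷ shift B)           ≡⟨ des-suc∷shift++0∷ a A (shift B) ⟩
  des (shift (a ∷ A)) + suc (des (0 ∷ shift B))  ≡⟨ cong₂ (λ d e → d + suc e) (des-shift (a ∷ A)) (des-0∷shift B) ⟩
  des (a ∷ A) + suc (des B)                      ≡⟨ +-suc (des (a ∷ A)) (des B) ⟩
  suc (des (a ∷ A) + des B)                      ∎
  where open ≡-Reasoning

stepOK⇒bounded : ∀ p xs → T (stepOK p xs) → All (_≤ length xs + p) xs
stepOK⇒bounded p []       _ = []
stepOK⇒bounded p (y ∷ ys) t with Equivalence.to T-∧ t
... | y≤ᵇsp , ys-ok =
  ≤-trans y≤sp (s≤s (m≤n+m p (length ys))) ∷ All.map ys≤ (stepOK⇒bounded y ys ys-ok)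
  where
  y≤sp : y ≤ suc p
  y≤sp = ≤ᵇ⇒≤ y (suc p) y≤ᵇsp
  ys≤ : ∀ {z} → z ≤ length ys + y → z ≤ suc (length ys + p)
  ys≤ z≤ = ≤-trans z≤ (≤-trans (+-monoʳ-≤ (length ys) y≤sp) (≤-reflexive (+-suc (length ys) p)))

catalan⇒bounded : ∀ w → T (isCatalan w) → All (_< length w) w
catalan⇒bounded []          _  = []
catalan⇒bounded (zero ∷ xs) t =
  s≤s z≤n ∷ All.map (λ x≤ → s≤s (≤-trans x≤ (≤-reflexive (+-identityʳ _)))) (stepOK⇒bounded 0 xs t)
catalan⇒bounded (suc _ ∷ _) ()

admissible : ℕ → List ℕ → Bool
admissible k w = isCatalan w ∧ (not (hasTriple w) ∧ (des w ≡ᵇ k))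

c : ℕ → ℕ → ℕ
c n k = ∑Words n n (𝟙 ∘ admissible k)

cnk≡c : ∀ n k → cnk p000 n k ≡ c n k
cnk≡c n k = begin
  count (λ w → avoids p000 w ∧ (des w ≡ᵇ k)) (catalanWords n)
    ≡⟨ count-filter isCatalan (λ w → avoids p000 w ∧ (des w ≡ᵇ k)) (wordsOver n n) ⟩
  count (λ w → isCatalan w ∧ (avoids p000 w ∧ (des w ≡ᵇ k))) (wordsOver n n)
    ≡⟨ count-wordsOver _ n n ⟩
  ∑Words n n (λ w → 𝟙 (isCatalan w ∧ (not (contains p000 w) ∧ (des w ≡ᵇ k))))
    ≡⟨ ∑Words-cong n n (λ w _ → cong (λ b → 𝟙 (isCatalan w ∧ (not b ∧ (des w ≡ᵇ k)))) (contains-000 w)) ⟩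
  c n k ∎
  where open ≡-Reasoning

admissible-hasTriple : ∀ k w → T (hasTriple w) → 𝟙 (admissible k w) ≡ 0
admissible-hasTriple k w t rewrite Equivalence.to T-≡ t = cong 𝟙 (∧-zeroʳ (isCatalan w))

c-stable : ∀ m n k → n ≤ m → ∑Words m n (𝟙 ∘ admissible k) ≡ c n k
c-stable m n k n≤m = go (≤⇒≤′ n≤m)
  where
  go : ∀ {m} → n ≤′ m → ∑Words m n (𝟙 ∘ admissible k) ≡ c n k
  go ≤′-refl            = refl
  go (≤′-step {m} n≤′m) = trans (∑Words-stable m n outside) (go n≤′m)
    where
    outside : ∀ w → length w ≡ n → ¬ All (_< m) w → 𝟙 (admissible k w) ≡ 0
    outside w refl ¬w<m with isCatalan w in cat
    ... | false = refl
    ... | true  = contradiction (All.map (λ x<n → <-≤-trans x<n (≤′⇒≤ n≤′m))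
                                         (catalan⇒bounded w (Equivalence.from T-≡ cat))) ¬w<m

pairAdmissible : ℕ → List ℕ → List ℕ → Bool
pairAdmissible k A B = (isCatalan A ∧ isCatalan B) ∧ (not (hasTriple (A ++ B)) ∧ (des A + des B ≡ᵇ k))

pairCount : ℕ → ℕ → ℕ → ℕ → ℕ
pairCount m i j k = ∑Words m i (λ A → ∑Words m j (λ B → 𝟙 (pairAdmissible k A B)))

pairAdmissible-[] : ∀ k A → pairAdmissible k A [] ≡ admissible k A
pairAdmissible-[] k A rewrite ∧-identityʳ (isCatalan A) | ++-identityʳ A | +-identityʳ (des A) = refl

pairAdmissible-0∷shift : ∀ k A B → pairAdmissible k (0 ∷ shift A) (0 ∷ shift B) ≡ pairAdmissible k A B
pairAdmissible-0∷shift k A B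
  rewrite isCatalan-0∷shift A | isCatalan-0∷shift B | hasTriple-0∷shift++0∷shift A B
        | des-0∷shift A | des-0∷shift B = refl

pairAdmissible-suc∷ʳ : ∀ k A b B → 𝟙 (pairAdmissible k A (suc b ∷ B)) ≡ 0
pairAdmissible-suc∷ʳ k A b B rewrite ∧-zeroʳ (isCatalan A) = refl

pairAdmissible-hasTriple : ∀ k A B → T (hasTriple (A ++ B)) → 𝟙 (pairAdmissible k A B) ≡ 0
pairAdmissible-hasTriple k A B t rewrite Equivalence.to T-≡ t = cong 𝟙 (∧-zeroʳ (isCatalan A ∧ isCatalan B))

pairCount-shift : ∀ m i j k → pairCount (suc m) (suc i) (suc j) k ≡ pairCount m i j k
pairCount-shift m i j k = begin
  ∑Words (suc m) (suc i) (λ A → ∑Words (suc m) (suc j) (F A))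
    ≡⟨ ∑Words-head-zero m i {λ A → ∑Words (suc m) (suc j) (F A)}
         (λ a A → ∑Words-vanish (suc m) (suc j) (λ _ _ → refl)) ⟩
  ∑Words (suc m) i (λ A → ∑Words (suc m) (suc j) (F (0 ∷ A)))
    ≡⟨ ∑Words-cong (suc m) i (λ A _ → ∑Words-head-zero m j {F (0 ∷ A)} (pairAdmissible-suc∷ʳ k (0 ∷ A))) ⟩
  ∑Words (suc m) i (λ A → ∑Words (suc m) j (F (0 ∷ A) ∘ (0 ∷_)))
    ≡⟨ ∑Words-cong (suc m) i (λ A _ → ∑Words-shift m j (λ B 0∈B → two-zeros-vanish A B (inj₂ 0∈B))) ⟩
  ∑Words (suc m) i (λ A → ∑Words m j (F (0 ∷ A) ∘ (0 ∷_) ∘ shift))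
    ≡⟨ ∑Words-shift m i (λ A 0∈A → ∑Words-vanish m j (λ B _ → two-zeros-vanish A (shift B) (inj₁ 0∈A))) ⟩
  ∑Words m i (λ A → ∑Words m j (λ B → F (0 ∷ shift A) (0 ∷ shift B)))
    ≡⟨ ∑Words-cong m i (λ A _ → ∑Words-cong m j (λ B _ → cong 𝟙 (pairAdmissible-0∷shift k A B))) ⟩
  pairCount m i j k ∎
  where
  open ≡-Reasoning
  F : List ℕ → List ℕ → ℕ
  F A B = 𝟙 (pairAdmissible k A B)
  two-zeros-vanish : ∀ A B → 0 ∈ A ⊎ 0 ∈ B → F (0 ∷ A) (0 ∷ B) ≡ 0
  two-zeros-vanish A B third-zero =
    pairAdmissible-hasTriple k (0 ∷ A) (0 ∷ B) (third-zero⇒hasTriple A B third-zero)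

pairCount-stable : ∀ m i j k → i ≤ m → j ≤ m → pairCount m i j k ≡ c ∣ i - j ∣ k
pairCount-stable m       zero    j       k _         j≤m       = c-stable m j k j≤m
pairCount-stable m       (suc i) zero    k i≤m       _         =
  trans (∑Words-cong m (suc i) (λ A _ → cong 𝟙 (pairAdmissible-[] k A))) (c-stable m (suc i) k i≤m)
pairCount-stable (suc m) (suc i) (suc j) k (s≤s i≤m) (s≤s j≤m) =
  trans (pairCount-shift m i j k) (pairCount-stable m i j k i≤m j≤m)

admissible-0∷shift : ∀ k A → admissible k (0 ∷ shift A) ≡ admissible k A
admissible-0∷shift k A rewrite isCatalan-0∷shift A | hasTriple-0∷shift A | des-0∷shift A = refl

admissible-0∷0∷shift : ∀ k B → admissible k (0 ∷ 0 ∷ shift B) ≡ admissible k B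
admissible-0∷0∷shift k B
  rewrite isCatalan-0∷shift++0∷shift [] B | hasTriple-0∷shift++0∷shift [] B | des-0∷shift B = refl

admissible-0-two-zeros : ∀ a A B → 𝟙 (admissible 0 (0 ∷ shift (a ∷ A) ++ 0 ∷ shift B)) ≡ 0
admissible-0-two-zeros a A B
  rewrite des-0∷shift++0∷shift a A B | ∧-zeroʳ (not (hasTriple (0 ∷ shift (a ∷ A) ++ 0 ∷ shift B))) =
  cong 𝟙 (∧-zeroʳ (isCatalan (0 ∷ shift (a ∷ A) ++ 0 ∷ shift B)))

admissible-suc-two-zeros : ∀ k a A B →
  admissible (suc k) (0 ∷ shift (a ∷ A) ++ 0 ∷ shift B) ≡ pairAdmissible k (a ∷ A) B
admissible-suc-two-zeros k a A B
  rewrite isCatalan-0∷shift++0∷shift (a ∷ A) B | hasTriple-0∷shift++0∷shift (a ∷ A) B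
        | des-0∷shift++0∷shift a A B = refl

-- Admissible words of length n + 1 whose only 0s are at positions 0 and i + 1.
twoZeroCount : ℕ → ℕ → ℕ → ℕ
twoZeroCount n i k =
  ∑Words n i (λ A → ∑Words n (n ∸ suc i) (λ B → 𝟙 (admissible k (0 ∷ shift A ++ 0 ∷ shift B))))

c-suc : ∀ n k → c (suc n) k ≡ c n k + ∑[ i < n ] twoZeroCount n (toℕ i) k
c-suc n k = begin
  ∑Words (suc n) (suc n) f
    ≡⟨ ∑Words-head-zero n n {f} (λ _ _ → refl) ⟩
  ∑Words (suc n) n (f ∘ (0 ∷_))
    ≡⟨ ∑Words-split-zero n n (f ∘ (0 ∷_)) ⟩
  ∑Words n n (f ∘ (0 ∷_) ∘ shift) +
  ∑[ i < n ] ∑Words n (toℕ i) (λ A → ∑Words (suc n) (n ∸ suc (toℕ i)) (λ v → f (0 ∷ shift A ++ 0 ∷ v)))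
    ≡⟨ cong₂ _+_ one-zero (sum-cong-≗ {n} two-zeros) ⟩
  c n k + ∑[ i < n ] twoZeroCount n (toℕ i) k ∎
  where
  open ≡-Reasoning
  f : List ℕ → ℕ
  f = 𝟙 ∘ admissible k
  one-zero : ∑Words n n (f ∘ (0 ∷_) ∘ shift) ≡ c n k
  one-zero = ∑Words-cong n n (λ A _ → cong 𝟙 (admissible-0∷shift k A))
  two-zeros : ∀ i →
    ∑Words n (toℕ i) (λ A → ∑Words (suc n) (n ∸ suc (toℕ i)) (λ v → f (0 ∷ shift A ++ 0 ∷ v))) ≡
    twoZeroCount n (toℕ i) k
  two-zeros i = ∑Words-cong n (toℕ i) (λ A _ → ∑Words-shift n (n ∸ suc (toℕ i)) (λ v 0∈v →
    admissible-hasTriple k (0 ∷ shift A ++ 0 ∷ v) (third-zero⇒hasTriple (shift A) v (inj₂ 0∈v))))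

twoZeroCount-0 : ∀ n k → twoZeroCount (suc n) 0 k ≡ c n k
twoZeroCount-0 n k =
  trans (∑Words-cong (suc n) n (λ B _ → cong 𝟙 (admissible-0∷0∷shift k B))) (c-stable (suc n) n k (n≤1+n n))

twoZeroCount-suc-0 : ∀ n i → twoZeroCount n (suc i) 0 ≡ 0
twoZeroCount-suc-0 n i = ∑Words-vanish n (suc i) vanish
  where
  vanish : ∀ A → length A ≡ suc i →
    ∑Words n (n ∸ suc (suc i)) (λ B → 𝟙 (admissible 0 (0 ∷ shift A ++ 0 ∷ shift B))) ≡ 0
  vanish (a ∷ A) _ = ∑Words-vanish n (n ∸ suc (suc i)) (λ B _ → admissible-0-two-zeros a A B)

twoZeroCount-suc-suc : ∀ n i k → suc i < n → twoZeroCount n (suc i) (suc k) ≡ c ∣ suc i - (n ∸ suc (suc i)) ∣ k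
twoZeroCount-suc-suc n i k i+1<n =
  trans (∑Words-cong n (suc i) as-pairs)
        (pairCount-stable n (suc i) (n ∸ suc (suc i)) k (<⇒≤ i+1<n) (m∸n≤m n (suc (suc i))))
  where
  as-pairs : ∀ A → length A ≡ suc i →
    ∑Words n (n ∸ suc (suc i)) (λ B → 𝟙 (admissible (suc k) (0 ∷ shift A ++ 0 ∷ shift B))) ≡
    ∑Words n (n ∸ suc (suc i)) (λ B → 𝟙 (pairAdmissible k A B))
  as-pairs (a ∷ A) _ = ∑Words-cong n (n ∸ suc (suc i)) (λ B _ → cong 𝟙 (admissible-suc-two-zeros k a A B))

pairTotal : ℕ → ℕ → ℕ
pairTotal n k = ∑[ i < n ] c ∣ suc (toℕ i) - (n ∸ suc (toℕ i)) ∣ k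

timesY : (ℕ → ℕ → ℕ) → ℕ → ℕ → ℕ
timesY f n zero    = 0
timesY f n (suc k) = f n k

c-suc-suc : ∀ n k → c (2 + n) k ≡ c (1 + n) k + (c n k + timesY pairTotal n k)
c-suc-suc n k = trans (c-suc (suc n) k) (cong (c (suc n) k +_) (cong₂ _+_ (twoZeroCount-0 n k) (two-zeros k)))
  where
  two-zeros : ∀ k → ∑[ i < n ] twoZeroCount (suc n) (suc (toℕ i)) k ≡ timesY pairTotal n k
  two-zeros zero    = ∑-vanish n (λ i → twoZeroCount-suc-0 (suc n) (toℕ i))
  two-zeros (suc k) = sum-cong-≗ {n} (λ i → twoZeroCount-suc-suc (suc n) (toℕ i) k (s≤s (toℕ<n i)))

pairTotal-suc-suc : ∀ n k → pairTotal (2 + n) k ≡ c n k + pairTotal n k + c (2 + n) k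
pairTotal-suc-suc n k = begin
  term 0F + ∑[ i < suc n ] term (Fin.suc i)
    ≡⟨ cong (c n k +_) (sum-init-last (term ∘ Fin.suc)) ⟩
  c n k + (∑[ i < n ] term (Fin.suc (inject₁ i)) + term (Fin.suc (fromℕ n)))
    ≡⟨ cong (c n k +_) (cong₂ _+_ (sum-cong-≗ {n} inner) last) ⟩
  c n k + (pairTotal n k + c (2 + n) k)
    ≡⟨ +-assoc (c n k) _ _ ⟨
  c n k + pairTotal n k + c (2 + n) k ∎
  where
  open ≡-Reasoning
  term : Fin (2 + n) → ℕ
  term i = c ∣ suc (toℕ i) - (2 + n ∸ suc (toℕ i)) ∣ k
  inner : ∀ i → term (Fin.suc (inject₁ i)) ≡ c ∣ suc (toℕ i) - (n ∸ suc (toℕ i)) ∣ k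
  inner i rewrite toℕ-inject₁ i | +-∸-assoc 1 (toℕ<n i) = refl
  last : term (Fin.suc (fromℕ n)) ≡ c (2 + n) k
  last rewrite toℕ-fromℕ n | n∸n≡0 n = refl

timesY-pairTotal-suc-suc : ∀ n k →
  timesY pairTotal (2 + n) k ≡ timesY c n k + timesY pairTotal n k + timesY c (2 + n) k
timesY-pairTotal-suc-suc n zero    = refl
timesY-pairTotal-suc-suc n (suc k) = pairTotal-suc-suc n k

c-recurrence : ∀ N k →
  c (4 + N) k + c (1 + N) k + c N k ≡ c (3 + N) k + c (2 + N) k + c (2 + N) k + timesY c (2 + N) k + timesY c N k
c-recurrence N k = begin
  c (4 + N) k + c₁ + c₀                             ≡⟨ cong (λ t → t + c₁ + c₀) (c-suc-suc (2 + N) k) ⟩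
  c₃ + (c₂ + timesY pairTotal (2 + N) k) + c₁ + c₀  ≡⟨ cong (λ t → c₃ + (c₂ + t) + c₁ + c₀) (timesY-pairTotal-suc-suc N k) ⟩
  c₃ + (c₂ + (y₀ + e₀ + y₂)) + c₁ + c₀              ≡⟨ rearrange c₀ c₁ c₂ c₃ e₀ y₀ y₂ ⟩
  c₃ + c₂ + (c₁ + (c₀ + e₀)) + y₂ + y₀              ≡⟨ cong (λ t → c₃ + c₂ + t + y₂ + y₀) (c-suc-suc N k) ⟨
  c₃ + c₂ + c₂ + y₂ + y₀                            ∎
  where
  open ≡-Reasoning
  c₀ c₁ c₂ c₃ e₀ y₀ y₂ : ℕ
  c₀ = c N k
  c₁ = c (1 + N) k
  c₂ = c (2 + N) k
  c₃ = c (3 + N) k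
  e₀ = timesY pairTotal N k
  y₀ = timesY c N k
  y₂ = timesY c (2 + N) k
  rearrange : ∀ c₀ c₁ c₂ c₃ e₀ y₀ y₂ →
    c₃ + (c₂ + (y₀ + e₀ + y₂)) + c₁ + c₀ ≡ c₃ + c₂ + (c₁ + (c₀ + e₀)) + y₂ + y₀
  rearrange = solve-∀

denom-identity : ∀ (a b c d e f g : ℤ) →
  pos 1 ℤ.* a ℤ.+ (ℤ.- pos 1 ℤ.* b ℤ.+ (ℤ.- pos 2 ℤ.* c ℤ.+ (ℤ.- pos 1 ℤ.* d ℤ.+
    (pos 1 ℤ.* e ℤ.+ (pos 1 ℤ.* f ℤ.+ (ℤ.- pos 1 ℤ.* g ℤ.+ pos 0))))))
  ≡ (a ℤ.+ e ℤ.+ f) ℤ.- (b ℤ.+ c ℤ.+ c ℤ.+ d ℤ.+ g)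
denom-identity = ℤ-solve-∀

mulCoeff-denom : ∀ (f : ℕ → ℕ → ℕ) N k →
  mulCoeff denom f (4 + N) k ≡
  pos (f (4 + N) k + f (1 + N) k + f N k) ℤ.-
  pos (f (3 + N) k + f (2 + N) k + f (2 + N) k + timesY f (2 + N) k + timesY f N k)
mulCoeff-denom f N zero    =
  denom-identity (pos (f (4 + N) 0)) (pos (f (3 + N) 0)) (pos (f (2 + N) 0)) (pos 0)
                 (pos (f (1 + N) 0)) (pos (f N 0)) (pos 0)
mulCoeff-denom f N (suc k) =
  denom-identity (pos (f (4 + N) (suc k))) (pos (f (3 + N) (suc k))) (pos (f (2 + N) (suc k))) (pos (f (2 + N) k))
                 (pos (f (1 + N) (suc k))) (pos (f N (suc k))) (pos (f N k))

mulCoeff-cong : ∀ P {f g : ℕ → ℕ → ℕ} → (∀ a b → f a b ≡ g a b) → ∀ n k → mulCoeff P f n k ≡ mulCoeff P g n k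
mulCoeff-cong []                f≗g n k = refl
mulCoeff-cong ((i , j , z) ∷ P) f≗g n k =
  cong₂ (λ u v → (if (i ≤ᵇ n) ∧ (j ≤ᵇ k) then z ℤ.* pos u else pos 0) ℤ.+ v)
        (f≗g (n ∸ i) (k ∸ j)) (mulCoeff-cong P f≗g n k)

denom·c≡numer : ∀ n k → mulCoeff denom c n k ≡ polyCoeff numer n k
denom·c≡numer 0 0                         = refl
denom·c≡numer 0 (suc k)                   = refl
denom·c≡numer 1 0                         = refl
denom·c≡numer 1 (suc k)                   = refl
denom·c≡numer 2 0                         = refl
denom·c≡numer 2 1                         = refl
denom·c≡numer 2 (suc (suc k))             = refl
denom·c≡numer 3 0                         = refl
denom·c≡numer 3 1                         = refl
denom·c≡numer 3 (suc (suc k))             = refl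
denom·c≡numer (suc (suc (suc (suc N)))) k = begin
  mulCoeff denom c (4 + N) k ≡⟨ mulCoeff-denom c N k ⟩
  pos L ℤ.- pos R            ≡⟨ cong (λ t → pos t ℤ.- pos R) (c-recurrence N k) ⟩
  pos R ℤ.- pos R            ≡⟨ ℤ.+-inverseʳ (pos R) ⟩
  pos 0                      ∎
  where
  open ≡-Reasoning
  L R : ℕ
  L = c (4 + N) k + c (1 + N) k + c N k
  R = c (3 + N) k + c (2 + N) k + c (2 + N) k + timesY c (2 + N) k + timesY c N k

theorem10 : ∀ (n k : ℕ) → mulCoeff denom (cnk p000) n k ≡ polyCoeff numer n k
theorem10 n k = trans (mulCoeff-cong denom cnk≡c n k) (denom·c≡numer n k)
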